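{- Let $k\ge2$, let $1\le n_1\le n_2\le\cdots\le n_k$ be integers, $N=\prod_{i=2}^k n_i$, $d$ a positive divisor of $N$, and $m_1,\ldots,m_k$ positive integers with $m_1=n_1$, $m_i\mid n_i$ for $2\le i\le k$, and $\prod_{i=2}^k m_i=d$. Identify the edges of $\mathcal{K}_{n_1,\ldots,n_k}$ with the elements of $\prod_{i=1}^k(\mathbb{Z}_{m_i}\times\mathbb{Z}_{n_i/m_i})$ (the $i$-th coordinate being the vertex of the edge in the $i$-th part $\mathbb{Z}_{m_i}\times\mathbb{Z}_{n_i/m_i}$), with coordinatewise addition. For $x\in[d]$ let $x_2,\ldots,x_k$ with $x_i\in[m_i]$ be the unique integers with $x=\sum_{i=2}^k x_i\prod_{j=i+1}^k m_j$, and for $y\in[N/d]$ let $y_2,\ldots,y_k$ with $y_i\in[n_i/m_i]$ be the unique integers with $y=\sum_{i=2}^k y_i\prod_{j=i+1}^k (n_j/m_j)$; put $\langle(x,y)\rangle=((0,0),(x_2,y_2),\ldots,(x_k,y_k))$. For $z\in[n_1]$ put $\langle z^*\rangle=((z_{1,1},z_{1,2}),\ldots,(z_{k,1},z_{k,2}))$, where $z_{i,1}\in[m_i]$, $z_{i,2}\in[n_i/m_i]$ and $z=z_{i,1}\frac{n_i}{m_i}+z_{i,2}$. For $i\in[d]$ and $j\in[N/d]$ let $\mathcal{M}_{i,j}=\{\langle z^*\rangle+\langle(i,j)\rangle: z\in[n_1]\}$ with ordering $\ell_{i,j}(\langle z^*\rangle+\langle(i,j)\rangle)=z$, and set $\ell_{i,N/d}:=\ell_{i,0}$.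 Then $ms(\ell_{i,j},\ell_{i,j+1})\ge n_1-1$ for all $i\in[d]$ and $j\in[N/d]$.
   Context: $[n]=\{0,1,\ldots,n-1\}$ and $\mathbb{Z}_m=[m]$ with arithmetic modulo $m$. $\mathcal{K}_{n_1,\ldots,n_k}$ is the complete $k$-partite $k$-graph: vertex set a disjoint union of parts of sizes $n_1,\ldots,n_k$, with exactly one edge for each $k$-set meeting every part in exactly one vertex. A matching is a set of edges no two sharing a vertex. For orderings $\ell,\ell'$ (listings of finite edge sets each with at least $s-1$ edges), $\ell\vee_s\ell'$ is the sequence of the last $s-1$ edges of $\ell$ in order followed by the first $s-1$ edges of $\ell'$ in order; $ms(\ell,\ell')$ is the largest $s$ such that every $s$ consecutive terms of $\ell\vee_s\ell'$ have no vertex lying in two of them (i.e. form a matching). -}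

module Defs where

open import Data.Nat using (ℕ; zero; suc; _+_; _*_; _∸_; _≤_; _<_; _<ᵇ_)
open import Data.Nat.DivMod using (_/_; _%_)
open import Data.Nat.Properties using (_≟_)
open import Data.Bool using (if_then_else_)
open import Data.Product using (_×_; _,_)
open import Relation.Binary.PropositionalEquality using (_≡_; _≢_)
open import Relation.Nullary using (yes; no)

-- Total division / remainder (the divisor-zero cases never arise under
-- the hypotheses of the lemma; they are only there to avoid NonZero proofs).
_/′_ : ℕ → ℕ → ℕ
a /′ zero = 0
a /′ suc b = a / suc b

_%′_ : ℕ → ℕ → ℕ
a %′ zero = a
a %′ suc b = a % suc b

prodLen : (ℕ → ℕ) → ℕ → ℕ → ℕ
prodLen f a zero = 1
prodLen f a (suc l) = f a * prodLen f (suc a) l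

-- prodFromTo f a b = Π_{j=a}^{b} f j   (empty product 1 if b < a)
prodFromTo : (ℕ → ℕ) → ℕ → ℕ → ℕ
prodFromTo f a b = prodLen f a (suc b ∸ a)

-- Parts are indexed by p ∈ {1,…,k}; the vertex of
-- an edge in part p is a pair (a , b) standing for an element of
-- ℤ_{m_p} × ℤ_{n_p/m_p}.  An edge is the map p ↦ its vertex in part p.

Edge : Set
Edge = ℕ → ℕ × ℕ

-- two edges share no vertex (vertices in different parts are distinct)
Disjoint : ℕ → Edge → Edge → Set
Disjoint k e e′ = ∀ p → 1 ≤ p → p ≤ k → e p ≢ e′ p

record Ordering : Set where
  constructor ordering
  field
    len : ℕ
    at  : ℕ → Edge
open Ordering public

-- ℓ ∨_s ℓ′ : last s-1 terms of ℓ then first s-1 terms of ℓ′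
-- (a sequence of length 2(s-1), indexed from 0)
join : ℕ → Ordering → Ordering → ℕ → Edge
join s ℓ ℓ′ q =
  if q <ᵇ (s ∸ 1) then at ℓ (len ℓ ∸ (s ∸ 1) + q) else at ℓ′ (q ∸ (s ∸ 1))

WindowsMatch : ℕ → ℕ → Ordering → Ordering → Set
WindowsMatch k s ℓ ℓ′ =
  ∀ t → t + s ≤ 2 * (s ∸ 1) →
  ∀ a b → t ≤ a → a < b → b < t + s →
  Disjoint k (join s ℓ ℓ′ a) (join s ℓ ℓ′ b)

MsProp : ℕ → Ordering → Ordering → ℕ → Set
MsProp k ℓ ℓ′ s = (1 ≤ s × s ∸ 1 ≤ len ℓ × s ∸ 1 ≤ len ℓ′) × WindowsMatch k s ℓ ℓ′

IsMs : ℕ → Ordering → Ordering → ℕ → Set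
IsMs k ℓ ℓ′ s = MsProp k ℓ ℓ′ s × (∀ s′ → MsProp k ℓ ℓ′ s′ → s′ ≤ s)

-- mixed-radix digit: x = Σ_{p=2}^{k} x_p Π_{j=p+1}^{k} r_j with x_p ∈ [r_p]
digit : ℕ → (ℕ → ℕ) → ℕ → ℕ → ℕ
digit k r x p = (x /′ prodFromTo r (suc p) k) %′ r p

shiftE : ℕ → (ℕ → ℕ) → (ℕ → ℕ) → ℕ → ℕ → Edge
shiftE k n m x y zero = (0 , 0)
shiftE k n m x y (suc zero) = (0 , 0)
shiftE k n m x y (suc (suc p)) =
  (digit k m x (suc (suc p)) , digit k (λ i → n i /′ m i) y (suc (suc p)))

zStar : (ℕ → ℕ) → (ℕ → ℕ) → ℕ → Edge
zStar n m z p = (z /′ (n p /′ m p) , z %′ (n p /′ m p))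

addE : (ℕ → ℕ) → (ℕ → ℕ) → Edge → Edge → Edge
addE n m e e′ p with e p | e′ p
... | (a , b) | (c , d) = ((a + c) %′ m p , (b + d) %′ (n p /′ m p))

ellRaw : ℕ → (ℕ → ℕ) → (ℕ → ℕ) → ℕ → ℕ → Ordering
ellRaw k n m i j = ordering (n 1) (λ z → addE n m (zStar n m z) (shiftE k n m i j))

ell : ℕ → (ℕ → ℕ) → (ℕ → ℕ) → ℕ → ℕ → ℕ → Ordering
ell k n m d i j with j ≟ (prodFromTo n 2 k /′ d)
... | yes _ = ellRaw k n m i 0
... | no _ = ellRaw k n m i j

module Submission where

open import Defs
open import Data.Nat using (ℕ; suc; _∸_; _≤_; _<_)
open import Data.Nat.Divisibility using (_∣_)
open import Data.Product using (_×_; ∃-syntax)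
open import Relation.Binary.PropositionalEquality using (_≡_)

open import Data.Nat using (zero; _+_; _*_; _≮_; _<ᵇ_; z≤n; s≤s; NonZero; _≟_; _≤?_; _<?_)
open import Data.Nat.Properties
open import Data.Nat.DivMod
open import Data.Nat.Divisibility using (∣-refl)
open import Data.Bool using (true; false)
open import Data.Product using (_,_; proj₁; proj₂; map₂)
open import Data.Product.Properties using (≡-dec)
open import Data.Sum using (_⊎_; inj₁; inj₂)
open import Data.Empty using (⊥-elim)
open import Function using (_∘_)
open import Relation.Binary using (tri<; tri≈; tri>)
open import Relation.Binary.PropositionalEquality
  using (_≢_; refl; sym; trans; cong; cong₂; subst; subst₂; module ≡-Reasoning)
open import Relation.Nullary using (Dec; yes; no; contradiction; ofʸ; ofⁿ)
open import Relation.Nullary.Decidable using (map′; _×-dec_; _→-dec_; ¬?)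
open import Relation.Unary using (Decidable)
open import Algebra.Properties.CommutativeSemigroup +-commutativeSemigroup
  using (x∙yz≈y∙xz; xy∙z≈zy∙x)
open import Algebra.Properties.CommutativeSemigroup *-commutativeSemigroup using (interchange)

-- In part p, with q = n_p / m_p, the z-th edge of ℓ_{i,j} has the vertex
-- ((⌊z/q⌋ + x) mod m_p , (z mod q + y) mod q), where (x , y) is the p-th coordinate of ⟨(i,j)⟩.
-- As z < n₁ ≤ m_p q this is injective in z, so every ℓ_{i,j} lists a matching.  Passing from
-- j to j + 1 (or from N/d − 1 back to 0) raises every y-digit by 0 or 1 modulo its radix.  So if
-- the z-th edge of ℓ_{i,j} and the z′-th edge of ℓ_{i,j+1} meet in part p, then ⌊z/q⌋ = ⌊z′/q⌋
-- and z mod q exceeds z′ mod q by at most 1, whence z ≤ z′ + 1.  In a window of n₁ − 1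
-- consecutive terms of ℓ_{i,j} ∨ ℓ_{i,j+1}, however, a term z of the first ordering and a term
-- z′ of the second always satisfy z ≥ z′ + 2.  The maximum ms exists since admissibility of s is
-- decidable and forces s ≤ n₁ + 1.

module _ {P : ℕ → Set} (P? : Decidable P) where

  ∀-bounded? : ∀ B → (∀ {x} → B ≤ x → P x) → Dec (∀ x → P x)
  ∀-bounded? B beyond = map′ extend (λ all _ → all _) (allUpTo? P? B)
    where
    extend : (∀ {x} → x < B → P x) → ∀ x → P x
    extend below x with x <? B
    ... | yes x<B = below x<B
    ... | no x≮B = beyond (≮⇒≥ x≮B)

  maximal : ∀ {s₀} B → (∀ {s} → P s → s ≤ B) → P s₀ →
    ∃[ s ] ((P s × (∀ s′ → P s′ → s′ ≤ s)) × s₀ ≤ s)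
  maximal B bound Ps₀ with P? B
  ... | yes PB = B , (PB , λ _ → bound) , bound Ps₀
  maximal zero bound Ps₀ | no ¬P0 = ⊥-elim (¬P0 (subst P (n≤0⇒n≡0 (bound Ps₀)) Ps₀))
  maximal (suc B) bound Ps₀ | no ¬PB =
    maximal B (λ Ps → m<1+n⇒m≤n (≤∧≢⇒< (bound Ps) λ { refl → ¬PB Ps })) Ps₀

disjoint? : ∀ k e e′ → Dec (Disjoint k e e′)
disjoint? k e e′ =
  ∀-bounded? (λ p → (1 ≤? p) →-dec (p ≤? k) →-dec ¬? (≡-dec _≟_ _≟_ (e p) (e′ p)))
    (suc k) (λ k<p _ p≤k → contradiction p≤k (<⇒≱ k<p))

windowsMatch? : ∀ k s ℓ ℓ′ → Dec (WindowsMatch k s ℓ ℓ′)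
windowsMatch? k s ℓ ℓ′ = ∀-bounded? window? (suc W)
  (λ W<t t+s≤W → contradiction (≤-trans (m≤m+n _ s) t+s≤W) (<⇒≱ W<t))
  where
  W : ℕ
  W = 2 * (s ∸ 1)
  term : ℕ → Edge
  term = join s ℓ ℓ′
  window? : ∀ t →
    Dec (t + s ≤ W → ∀ a b → t ≤ a → a < b → b < t + s → Disjoint k (term a) (term b))
  window? t = (t + s ≤? W) →-dec ∀-bounded? pairs? (t + s)
      (λ t+s≤a b _ a<b b<t+s → contradiction t+s≤a (<⇒≱ (<-trans a<b b<t+s)))
    where
    pairs? : ∀ a → Dec (∀ b → t ≤ a → a < b → b < t + s → Disjoint k (term a) (term b))
    pairs? a =
      ∀-bounded?
        (λ b → (t ≤? a) →-dec (a <? b) →-dec (b <? t + s) →-dec disjoint? k (term a) (term b))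
        (t + s) (λ t+s≤b _ _ b<t+s → contradiction t+s≤b (<⇒≱ b<t+s))

msProp? : ∀ k ℓ ℓ′ s → Dec (MsProp k ℓ ℓ′ s)
msProp? k ℓ ℓ′ s =
  ((1 ≤? s) ×-dec (s ∸ 1 ≤? len ℓ) ×-dec (s ∸ 1 ≤? len ℓ′)) ×-dec windowsMatch? k s ℓ ℓ′

∃IsMs≥ : ∀ k ℓ ℓ′ {s₀} → MsProp k ℓ ℓ′ s₀ → ∃[ s ] (IsMs k ℓ ℓ′ s × s₀ ≤ s)
∃IsMs≥ k ℓ ℓ′ = maximal (msProp? k ℓ ℓ′) (suc (len ℓ)) admissible⇒≤
  where
  admissible⇒≤ : ∀ {s} → MsProp k ℓ ℓ′ s → s ≤ suc (len ℓ)
  admissible⇒≤ {s} ((_ , s∸1≤len , _) , _) = ≤-trans (m≤n+m∸n s 1) (s≤s s∸1≤len)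

msProp-1 : ∀ k ℓ ℓ′ → MsProp k ℓ ℓ′ 1
msProp-1 k ℓ ℓ′ =
  (≤-refl , z≤n , z≤n) , λ t t+1≤0 → contradiction (≤-trans (m≤n+m 1 t) t+1≤0) λ ()

ms-exists : ∀ k ℓ ℓ′ → ∃[ s ] IsMs k ℓ ℓ′ s
ms-exists k ℓ ℓ′ = map₂ proj₁ (∃IsMs≥ k ℓ ℓ′ (msProp-1 k ℓ ℓ′))

Matching : ℕ → Ordering → Set
Matching k ℓ = ∀ {z z′} → z < len ℓ → z′ < len ℓ → z ≢ z′ → Disjoint k (at ℓ z) (at ℓ z′)

CrossDisjoint : ℕ → Ordering → Ordering → Set
CrossDisjoint k ℓ ℓ′ = ∀ {z z′} → z < len ℓ → 2 + z′ ≤ z → Disjoint k (at ℓ z) (at ℓ′ z′)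

join-cases : ∀ N e ℓ′ q →
  (q < N × join (suc N) (ordering (2 + N) e) ℓ′ q ≡ e (2 + q)) ⊎
  (N ≤ q × join (suc N) (ordering (2 + N) e) ℓ′ q ≡ at ℓ′ (q ∸ N))
join-cases N e ℓ′ q with q <ᵇ N | <ᵇ-reflects-< q N
... | true  | ofʸ q<N = inj₁ (q<N , cong (λ x → e (x + q)) (m+n∸n≡m 2 N))
... | false | ofⁿ q≮N = inj₂ (≮⇒≥ q≮N , refl)

windowsMatch-len∸1 : ∀ {k N e e′} →
  let ℓ = ordering (2 + N) e ; ℓ′ = ordering (2 + N) e′ in
  Matching k ℓ → Matching k ℓ′ → CrossDisjoint k ℓ ℓ′ → WindowsMatch k (suc N) ℓ ℓ′
windowsMatch-len∸1 {k} {N} {e} {e′} match match′ cross t t+s≤2N a b t≤a a<b b<t+s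
  with join-cases N e (ordering (2 + N) e′) a | join-cases N e (ordering (2 + N) e′) b
... | inj₁ (a<N , ja) | inj₁ (b<N , jb) =
  subst₂ (Disjoint k) (sym ja) (sym jb)
    (match (s≤s (s≤s a<N)) (s≤s (s≤s b<N)) λ eq → <⇒≢ a<b (+-cancelˡ-≡ 2 a b eq))
... | inj₁ (a<N , ja) | inj₂ (N≤b , jb) =
  subst₂ (Disjoint k) (sym ja) (sym jb)
    (cross (s≤s (s≤s a<N)) (s≤s (s≤s (m≤n+o⇒m∸n≤o b N b≤N+a))))
  where
  b≤N+a : b ≤ N + a
  b≤N+a = ≤-trans (m<1+n⇒m≤n (subst (b <_) (+-suc t N) b<t+s))
                  (≤-trans (+-monoˡ-≤ N t≤a) (≤-reflexive (+-comm a N)))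
... | inj₂ (N≤a , _) | inj₁ (b<N , _) = contradiction (<-trans a<b b<N) (≤⇒≯ N≤a)
... | inj₂ (N≤a , ja) | inj₂ (N≤b , jb) =
  subst₂ (Disjoint k) (sym ja) (sym jb)
    (match′ (below (<-trans a<b b<2N) N≤a) (below b<2N N≤b) (<⇒≢ (∸-monoˡ-< a<b N≤a)))
  where
  b<2N : b < N + N
  b<2N = ≤-trans b<t+s (≤-trans t+s≤2N (≤-reflexive (cong (N +_) (+-identityʳ N))))
  below : ∀ {x} → x < N + N → N ≤ x → x ∸ N < 2 + N
  below x<2N N≤x = ≤-trans (∸-monoˡ-< x<2N N≤x) (≤-trans (≤-reflexive (m+n∸n≡m N N)) (m≤n+m N 2))

ms≥len∸1 : ∀ {k} ℓ ℓ′ → len ℓ ≡ len ℓ′ → Matching k ℓ → Matching k ℓ′ → CrossDisjoint k ℓ ℓ′ →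
  ∃[ s ] (IsMs k ℓ ℓ′ s × len ℓ ∸ 1 ≤ s)
ms≥len∸1 {k} ℓ@(ordering (suc (suc N)) e) ℓ′@(ordering _ e′) refl match match′ cross =
  ∃IsMs≥ k ℓ ℓ′ ((s≤s z≤n , N≤2+N , N≤2+N) , windowsMatch-len∸1 {k} {N} {e} {e′} match match′ cross)
  where
  N≤2+N : N ≤ 2 + N
  N≤2+N = m≤n+m N 2
ms≥len∸1 {k} ℓ@(ordering zero _) ℓ′ _ _ _ _ = map₂ (_, z≤n) (ms-exists k ℓ ℓ′)
ms≥len∸1 {k} ℓ@(ordering (suc zero) _) ℓ′ _ _ _ _ = map₂ (_, z≤n) (ms-exists k ℓ ℓ′)

%-/-injective : ∀ {a b} n .{{_ : NonZero n}} → a % n ≡ b % n → a / n ≡ b / n → a ≡ b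
%-/-injective {a} {b} n a%n≡b%n a/n≡b/n = begin
  a                 ≡⟨ m≡m%n+[m/n]*n a n ⟩
  a % n + a / n * n ≡⟨ cong₂ (λ r t → r + t * n) a%n≡b%n a/n≡b/n ⟩
  b % n + b / n * n ≡⟨ m≡m%n+[m/n]*n b n ⟨
  b                 ∎
  where open ≡-Reasoning

%≡∧/<⇒+≤ : ∀ {a b} n .{{_ : NonZero n}} → a % n ≡ b % n → a / n < b / n → n + a ≤ b
%≡∧/<⇒+≤ {a} {b} n a%n≡b%n a/n<b/n = begin
  n + a                       ≡⟨ cong (n +_) (m≡m%n+[m/n]*n a n) ⟩
  n + (a % n + a / n * n)     ≡⟨ cong (λ r → n + (r + a / n * n)) a%n≡b%n ⟩
  n + (b % n + a / n * n)     ≡⟨ x∙yz≈y∙xz n (b % n) (a / n * n) ⟩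
  b % n + suc (a / n) * n     ≤⟨ +-monoʳ-≤ (b % n) (*-monoˡ-≤ n a/n<b/n) ⟩
  b % n + b / n * n           ≡⟨ m≡m%n+[m/n]*n b n ⟨
  b                           ∎
  where open ≤-Reasoning

[a+x]/n≮[b+x]/n : ∀ {a b} x n .{{_ : NonZero n}} → b < n →
  (a + x) % n ≡ (b + x) % n → (a + x) / n ≮ (b + x) / n
[a+x]/n≮[b+x]/n {a} {b} x n b<n eq lt =
  <⇒≱ (<-≤-trans (+-monoˡ-< x b<n) (+-monoʳ-≤ n (m≤n+m x a))) (%≡∧/<⇒+≤ n eq lt)

+-%-cancelʳ-< : ∀ {a b} x n .{{_ : NonZero n}} → a < n → b < n →
  (a + x) % n ≡ (b + x) % n → a ≡ b
+-%-cancelʳ-< {a} {b} x n a<n b<n eq with <-cmp ((a + x) / n) ((b + x) / n)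
... | tri< lt _ _ = contradiction lt ([a+x]/n≮[b+x]/n x n b<n eq)
... | tri≈ _ quotients≡ _ = +-cancelʳ-≡ x a b (%-/-injective n eq quotients≡)
... | tri> _ _ gt = contradiction gt ([a+x]/n≮[b+x]/n x n a<n (sym eq))

/≡∧+≤⇒%+≤% : ∀ {a b} d n .{{_ : NonZero n}} → a / n ≡ b / n → d + a ≤ b → d + a % n ≤ b % n
/≡∧+≤⇒%+≤% {a} {b} d n a/n≡b/n d+a≤b = +-cancelʳ-≤ (b / n * n) (d + a % n) (b % n) (begin
  d + a % n + b / n * n   ≡⟨ cong (λ t → d + a % n + t * n) a/n≡b/n ⟨
  d + a % n + a / n * n   ≡⟨ +-assoc d (a % n) (a / n * n) ⟩
  d + (a % n + a / n * n) ≡⟨ cong (d +_) (m≡m%n+[m/n]*n a n) ⟨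
  d + a                   ≤⟨ d+a≤b ⟩
  b                       ≡⟨ m≡m%n+[m/n]*n b n ⟩
  b % n + b / n * n       ∎)
  where open ≤-Reasoning

[m%′n+o]%′n≡[m+o]%′n : ∀ m o n → (m %′ n + o) %′ n ≡ (m + o) %′ n
[m%′n+o]%′n≡[m+o]%′n m o zero = refl
[m%′n+o]%′n≡[m+o]%′n m o n@(suc _) = begin
  (m % n + o) % n         ≡⟨ %-distribˡ-+ (m % n) o n ⟩
  (m % n % n + o % n) % n ≡⟨ cong (λ r → (r + o % n) % n) (m%n%n≡m%n m n) ⟩
  (m % n + o % n) % n     ≡⟨ %-distribˡ-+ m o n ⟨
  (m + o) % n             ∎
  where open ≡-Reasoning

0/′n≡0 : ∀ n → 0 /′ n ≡ 0
0/′n≡0 zero = refl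
0/′n≡0 (suc n) = refl

0%′n≡0 : ∀ n → 0 %′ n ≡ 0
0%′n≡0 zero = refl
0%′n≡0 (suc n) = refl

[1+m]/′n≡m/′n+c : ∀ m n → ∃[ c ] (c ≤ 1 × suc m /′ n ≡ m /′ n + c)
[1+m]/′n≡m/′n+c m zero = 0 , z≤n , refl
[1+m]/′n≡m/′n+c m n@(suc _) = suc m / n ∸ m / n , c≤1 , sym (m+[n∸m]≡n (/-monoˡ-≤ n (n≤1+n m)))
  where
  open ≤-Reasoning
  c≤1 : suc m / n ∸ m / n ≤ 1
  c≤1 = m≤n+o⇒m∸n≤o (suc m / n) (m / n) (begin
    suc m / n     ≤⟨ /-monoˡ-≤ n (≤-trans (≤-reflexive (+-comm 1 m)) (+-monoʳ-≤ m (s≤s z≤n))) ⟩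
    (m + n) / n   ≡⟨ +-distrib-/-∣ʳ m ∣-refl ⟩
    m / n + n / n ≡⟨ cong (m / n +_) (n/n≡1 n) ⟩
    m / n + 1     ∎)

[m*[n*o]]/′o%′n≡0 : ∀ m n o → ((m * (n * o)) /′ o) %′ n ≡ 0
[m*[n*o]]/′o%′n≡0 m n zero = 0%′n≡0 n
[m*[n*o]]/′o%′n≡0 m zero o@(suc _) = trans (cong (_/ o) (*-zeroʳ m)) (0/′n≡0 o)
[m*[n*o]]/′o%′n≡0 m n@(suc _) o@(suc _) = begin
  (m * (n * o)) / o % n ≡⟨ cong (λ t → t / o % n) (*-assoc m n o) ⟨
  (m * n * o) / o % n   ≡⟨ cong (_% n) (m*n/n≡m (m * n) o) ⟩
  (m * n) % n           ≡⟨ m*n%n≡0 m n ⟩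
  0                     ∎
  where open ≡-Reasoning

m*[n/′m]≡n : ∀ m n → 1 ≤ m → m ∣ n → m * (n /′ m) ≡ n
m*[n/′m]≡n (suc _) n _ m∣n = m*[n/m]≡n m∣n

m*n≡o⇒1≤o⇒1≤n : ∀ m {n o} → m * n ≡ o → 1 ≤ o → 1 ≤ n
m*n≡o⇒1≤o⇒1≤n m {zero} m*0≡o 1≤o = contradiction (trans (sym m*0≡o) (*-zeroʳ m)) (n>0⇒n≢0 1≤o)
m*n≡o⇒1≤o⇒1≤n m {suc n} _ _ = s≤s z≤n

-- at (ellRaw k n m i j) z p reduces to vertex (m p) (n p /′ m p) (shiftE k n m i j p) z.
vertex : ℕ → ℕ → ℕ × ℕ → ℕ → ℕ × ℕ
vertex m q (x , y) z = ((z /′ q + x) %′ m , (z %′ q + y) %′ q)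

Fits : ℕ → ℕ → ℕ → Set
Fits L m q = 1 ≤ m × 1 ≤ q × L ≤ m * q

vertex-injective : ∀ {L m q} s {z z′} → Fits L m q → z < L → z′ < L →
  vertex m q s z ≡ vertex m q s z′ → z ≡ z′
vertex-injective {m = m@(suc _)} {q@(suc _)} (x , y) {z} {z′} (s≤s _ , s≤s _ , L≤mq) z<L z′<L eq =
  %-/-injective q
    (+-%-cancelʳ-< y q (m%n<n z q) (m%n<n z′ q) (cong proj₂ eq))
    (+-%-cancelʳ-< x m (m<n*o⇒m/o<n (<-≤-trans z<L L≤mq)) (m<n*o⇒m/o<n (<-≤-trans z′<L L≤mq))
      (cong proj₁ eq))

-- Equal first coordinates force ⌊z/q⌋ = ⌊z′/q⌋, hence z mod q ≥ z′ mod q + 2; equal second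
-- coordinates force z mod q = z′ mod q + c.
vertex-gap : ∀ {L m q} s s′ c {z z′} → Fits L m q → proj₁ s ≡ proj₁ s′ → c ≤ 1 →
  proj₂ s′ ≡ (proj₂ s + c) %′ q → z < L → 2 + z′ ≤ z → vertex m q s z ≢ vertex m q s′ z′
vertex-gap {m = m@(suc _)} {q@(suc _)} (x , y) (.x , y′) c {z} {z′} (s≤s _ , s≤s _ , L≤mq) refl
  c≤1 y′≡y+c z<L gap eq =
  <⇒≢ r′+c<r (sym r≡r′+c)
  where
  same-quotient : z / q ≡ z′ / q
  same-quotient = +-%-cancelʳ-< x m (m<n*o⇒m/o<n (<-≤-trans z<L L≤mq))
    (m<n*o⇒m/o<n (<-trans (<-trans (n<1+n z′) gap) (<-≤-trans z<L L≤mq)))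
    (cong proj₁ eq)
  r′+c<r : z′ % q + c < z % q
  r′+c<r = <-≤-trans (+-monoʳ-< (z′ % q) (s≤s c≤1))
             (subst (_≤ z % q) (+-comm 2 (z′ % q)) (/≡∧+≤⇒%+≤% 2 q (sym same-quotient) gap))
  r≡r′+c : z % q ≡ z′ % q + c
  r≡r′+c = +-%-cancelʳ-< y q (m%n<n z q) (<-trans r′+c<r (m%n<n z q)) (begin
    (z % q + y) % q            ≡⟨ cong proj₂ eq ⟩
    (z′ % q + y′) % q          ≡⟨ cong (λ t → (z′ % q + t) % q) y′≡y+c ⟩
    (z′ % q + (y + c) % q) % q ≡⟨ cong (_% q) (+-comm (z′ % q) _) ⟩
    ((y + c) % q + z′ % q) % q ≡⟨ [m%′n+o]%′n≡[m+o]%′n (y + c) (z′ % q) q ⟩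
    (y + c + z′ % q) % q       ≡⟨ cong (_% q) (xy∙z≈zy∙x y c (z′ % q)) ⟩
    (z′ % q + c + y) % q       ∎)
    where open ≡-Reasoning

prodLen-+ : ∀ f a l l′ → prodLen f a (l + l′) ≡ prodLen f a l * prodLen f (l + a) l′
prodLen-+ f a zero l′ = sym (+-identityʳ _)
prodLen-+ f a (suc l) l′ = begin
  f a * prodLen f (suc a) (l + l′)
    ≡⟨ cong (f a *_) (prodLen-+ f (suc a) l l′) ⟩
  f a * (prodLen f (suc a) l * prodLen f (l + suc a) l′)
    ≡⟨ cong (λ b → f a * (prodLen f (suc a) l * prodLen f b l′)) (+-suc l a) ⟩
  f a * (prodLen f (suc a) l * prodLen f (suc l + a) l′)
    ≡⟨ *-assoc (f a) _ _ ⟨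
  f a * prodLen f (suc a) l * prodLen f (suc l + a) l′
    ∎
  where open ≡-Reasoning

prodFromTo-split : ∀ f {a p k} → a ≤ p → p ≤ k →
  prodFromTo f a k ≡ prodLen f a (p ∸ a) * (f p * prodFromTo f (suc p) k)
prodFromTo-split f {a} {p} {k} a≤p p≤k = begin
  prodLen f a (suc k ∸ a)                                 ≡⟨ cong (prodLen f a) length ⟩
  prodLen f a ((p ∸ a) + suc (k ∸ p))                     ≡⟨ prodLen-+ f a (p ∸ a) (suc (k ∸ p)) ⟩
  prodLen f a (p ∸ a) * prodLen f (p ∸ a + a) (suc (k ∸ p))
    ≡⟨ cong (λ b → prodLen f a (p ∸ a) * prodLen f b (suc (k ∸ p))) (m∸n+n≡m a≤p) ⟩
  prodLen f a (p ∸ a) * (f p * prodFromTo f (suc p) k)    ∎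
  where
  open ≡-Reasoning
  length : suc k ∸ a ≡ (p ∸ a) + suc (k ∸ p)
  length = +-cancelʳ-≡ a _ _ (begin
    suc k ∸ a + a               ≡⟨ m∸n+n≡m (≤-trans a≤p (≤-trans p≤k (n≤1+n k))) ⟩
    suc k                       ≡⟨ cong suc (m+[n∸m]≡n p≤k) ⟨
    suc (p + (k ∸ p))           ≡⟨ +-suc p (k ∸ p) ⟨
    p + suc (k ∸ p)             ≡⟨ cong (_+ suc (k ∸ p)) (m∸n+n≡m a≤p) ⟨
    p ∸ a + a + suc (k ∸ p)     ≡⟨ +-assoc (p ∸ a) a _ ⟩
    p ∸ a + (a + suc (k ∸ p))   ≡⟨ cong (p ∸ a +_) (+-comm a _) ⟩
    p ∸ a + (suc (k ∸ p) + a)   ≡⟨ +-assoc (p ∸ a) _ a ⟨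
    p ∸ a + suc (k ∸ p) + a     ∎)

prodLen-* : ∀ f g h a l → (∀ i → a ≤ i → i < l + a → f i ≡ g i * h i) →
  prodLen f a l ≡ prodLen g a l * prodLen h a l
prodLen-* f g h a zero _ = refl
prodLen-* f g h a (suc l) f≡gh = begin
  f a * prodLen f (suc a) l
    ≡⟨ cong₂ _*_ (f≡gh a ≤-refl (s≤s (m≤n+m a l))) (prodLen-* f g h (suc a) l inner) ⟩
  g a * h a * (prodLen g (suc a) l * prodLen h (suc a) l) ≡⟨ interchange (g a) (h a) _ _ ⟩
  g a * prodLen g (suc a) l * (h a * prodLen h (suc a) l) ∎
  where
  open ≡-Reasoning
  inner : ∀ i → suc a ≤ i → i < l + suc a → f i ≡ g i * h i
  inner i a<i i<l+1+a = f≡gh i (<⇒≤ a<i) (≤-trans i<l+1+a (≤-reflexive (+-suc l a)))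

prodFromTo-* : ∀ f g h a b → (∀ i → a ≤ i → i ≤ b → f i ≡ g i * h i) →
  prodFromTo f a b ≡ prodFromTo g a b * prodFromTo h a b
prodFromTo-* f g h a b f≡gh = prodLen-* f g h a (suc b ∸ a) in-range
  where
  in-range : ∀ i → a ≤ i → i < (suc b ∸ a) + a → f i ≡ g i * h i
  in-range i a≤i i< with a ≤? suc b
  ... | yes a≤1+b = f≡gh i a≤i (m<1+n⇒m≤n (≤-trans i< (≤-reflexive (m∸n+n≡m a≤1+b))))
  ... | no a≰1+b =
    contradiction a≤i (<⇒≱ (≤-trans i< (≤-reflexive (cong (_+ a) (m≤n⇒m∸n≡0 (<⇒≤ (≰⇒> a≰1+b)))))))

radix : (ℕ → ℕ) → (ℕ → ℕ) → ℕ → ℕ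
radix n m p = n p /′ m p

prodFromTo-/′ : ∀ n m a b d → 1 ≤ d → (∀ i → a ≤ i → i ≤ b → n i ≡ m i * radix n m i) →
  prodFromTo m a b ≡ d → prodFromTo n a b /′ d ≡ prodFromTo (radix n m) a b
prodFromTo-/′ n m a b d@(suc _) _ n≡m*r ∏m≡d = begin
  prodFromTo n a b / d       ≡⟨ cong (_/ d) (prodFromTo-* n m (radix n m) a b n≡m*r) ⟩
  (prodFromTo m a b * Q) / d ≡⟨ cong (λ t → (t * Q) / d) ∏m≡d ⟩
  (d * Q) / d                ≡⟨ cong (_/ d) (*-comm d Q) ⟩
  (Q * d) / d                ≡⟨ m*n/n≡m Q d ⟩
  Q                          ∎
  where
  open ≡-Reasoning
  Q = prodFromTo (radix n m) a b

DigitStep : ℕ → (ℕ → ℕ) → ℕ → ℕ → Set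
DigitStep k r j j′ =
  ∀ p → 2 ≤ p → p ≤ k → ∃[ c ] (c ≤ 1 × digit k r j′ p ≡ (digit k r j p + c) %′ r p)

digitStep-suc : ∀ k r j → DigitStep k r j (suc j)
digitStep-suc k r j p _ _ with [1+m]/′n≡m/′n+c j (prodFromTo r (suc p) k)
... | c , c≤1 , eq = c , c≤1 , trans (cong (_%′ r p) eq) (sym ([m%′n+o]%′n≡[m+o]%′n _ c (r p)))

digit-zero : ∀ k r p → digit k r 0 p ≡ 0
digit-zero k r p = trans (cong (_%′ r p) (0/′n≡0 (prodFromTo r (suc p) k))) (0%′n≡0 (r p))

digit-prodFromTo : ∀ k r p → 2 ≤ p → p ≤ k → digit k r (prodFromTo r 2 k) p ≡ 0
digit-prodFromTo k r p 2≤p p≤k =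
  trans (cong (λ t → (t /′ prodFromTo r (suc p) k) %′ r p) (prodFromTo-split r 2≤p p≤k))
        ([m*[n*o]]/′o%′n≡0 (prodLen r 2 (p ∸ 2)) (r p) (prodFromTo r (suc p) k))

digitStep-wrap : ∀ k r j → suc j ≡ prodFromTo r 2 k → DigitStep k r j 0
digitStep-wrap k r j 1+j≡Q p 2≤p p≤k with digitStep-suc k r j p 2≤p p≤k
... | c , c≤1 , eq = c , c≤1 , (begin
  digit k r 0 p                    ≡⟨ digit-zero k r p ⟩
  0                                ≡⟨ digit-prodFromTo k r p 2≤p p≤k ⟨
  digit k r (prodFromTo r 2 k) p   ≡⟨ cong (λ t → digit k r t p) 1+j≡Q ⟨
  digit k r (suc j) p              ≡⟨ eq ⟩
  (digit k r j p + c) %′ r p       ∎)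
  where open ≡-Reasoning

shiftE-x : ∀ k n m i j j′ p → proj₁ (shiftE k n m i j p) ≡ proj₁ (shiftE k n m i j′ p)
shiftE-x k n m i j j′ zero = refl
shiftE-x k n m i j j′ (suc zero) = refl
shiftE-x k n m i j j′ (suc (suc p)) = refl

shiftE-y : ∀ {k n m} i {j j′} → DigitStep k (radix n m) j j′ → ∀ p → 1 ≤ p → p ≤ k →
  ∃[ c ] (c ≤ 1 × proj₂ (shiftE k n m i j′ p) ≡ (proj₂ (shiftE k n m i j p) + c) %′ radix n m p)
shiftE-y {n = n} {m} i step (suc zero) _ _ = 0 , z≤n , sym (0%′n≡0 (radix n m 1))
shiftE-y i step (suc (suc p)) _ p≤k = step (suc (suc p)) (s≤s (s≤s z≤n)) p≤k

AllFit : ℕ → (ℕ → ℕ) → (ℕ → ℕ) → Set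
AllFit k n m = ∀ p → 1 ≤ p → p ≤ k → Fits (n 1) (m p) (radix n m p)

ellRaw-matching : ∀ {k n m} i j → AllFit k n m → Matching k (ellRaw k n m i j)
ellRaw-matching {k} {n} {m} i j fits z<n₁ z′<n₁ z≢z′ p 1≤p p≤k =
  z≢z′ ∘ vertex-injective (shiftE k n m i j p) (fits p 1≤p p≤k) z<n₁ z′<n₁

ellRaw-cross : ∀ {k n m} i {j j′} → AllFit k n m → DigitStep k (radix n m) j j′ →
  CrossDisjoint k (ellRaw k n m i j) (ellRaw k n m i j′)
ellRaw-cross {k} {n} {m} i {j} {j′} fits step z<n₁ gap p 1≤p p≤k
  with shiftE-y i step p 1≤p p≤k
... | c , c≤1 , y′≡y+c =
  vertex-gap (shiftE k n m i j p) (shiftE k n m i j′ p) c (fits p 1≤p p≤k)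
    (shiftE-x k n m i j j′ p) c≤1 y′≡y+c z<n₁ gap

ellRaw-ms : ∀ {k n m} i {j j′} → AllFit k n m → DigitStep k (radix n m) j j′ →
  ∃[ s ] (IsMs k (ellRaw k n m i j) (ellRaw k n m i j′) s × n 1 ∸ 1 ≤ s)
ellRaw-ms i {j} {j′} fits step =
  ms≥len∸1 _ _ refl (ellRaw-matching i j fits) (ellRaw-matching i j′ fits)
    (ellRaw-cross i fits step)

ell-below : ∀ k n m d i j → j < prodFromTo n 2 k /′ d → ell k n m d i j ≡ ellRaw k n m i j
ell-below k n m d i j j<N/d with j ≟ prodFromTo n 2 k /′ d
... | yes j≡N/d = contradiction j≡N/d (<⇒≢ j<N/d)
... | no _ = refl

ell-suc : ∀ k n m d i j → prodFromTo n 2 k /′ d ≡ prodFromTo (radix n m) 2 k →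
  ∃[ j′ ] (ell k n m d i (suc j) ≡ ellRaw k n m i j′ × DigitStep k (radix n m) j j′)
ell-suc k n m d i j N/d≡Q with suc j ≟ prodFromTo n 2 k /′ d
... | yes 1+j≡N/d = 0 , refl , digitStep-wrap k (radix n m) j (trans 1+j≡N/d N/d≡Q)
... | no _ = suc j , refl , digitStep-suc k (radix n m) j

lemma4p5 : (k : ℕ) (n m : ℕ → ℕ) (d : ℕ) →
    2 ≤ k →
    1 ≤ n 1 →
    (∀ i j → 1 ≤ i → i ≤ j → j ≤ k → n i ≤ n j) →
    1 ≤ d → d ∣ prodFromTo n 2 k →
    (∀ i → 1 ≤ i → i ≤ k → 1 ≤ m i) →
    m 1 ≡ n 1 →
    (∀ i → 2 ≤ i → i ≤ k → m i ∣ n i) →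
    prodFromTo m 2 k ≡ d →
    ∀ i j → i < d → j < prodFromTo n 2 k /′ d →
    ∃[ s ] (IsMs k (ell k n m d i j) (ell k n m d i (suc j)) s × n 1 ∸ 1 ≤ s)
lemma4p5 k n m d _ 1≤n₁ mono 1≤d _ 1≤m m₁≡n₁ m∣n ∏m≡d i j _ j<N/d =
  let j′ , ell≡ellRaw , step = ell-suc k n m d i j N/d≡Q in
  subst₂ (λ ℓ ℓ′ → ∃[ s ] (IsMs k ℓ ℓ′ s × n 1 ∸ 1 ≤ s))
    (sym (ell-below k n m d i j j<N/d)) (sym ell≡ellRaw) (ellRaw-ms i fits step)
  where
  m*r≡n : ∀ p → 1 ≤ p → p ≤ k → m p * radix n m p ≡ n p
  m*r≡n (suc zero) 1≤p p≤k =
    m*[n/′m]≡n (m 1) (n 1) (1≤m 1 1≤p p≤k) (subst (_∣ n 1) (sym m₁≡n₁) ∣-refl)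
  m*r≡n p@(suc (suc _)) 1≤p p≤k =
    m*[n/′m]≡n (m p) (n p) (1≤m p 1≤p p≤k) (m∣n p (s≤s (s≤s z≤n)) p≤k)
  fits : AllFit k n m
  fits p 1≤p p≤k =
    1≤m p 1≤p p≤k , m*n≡o⇒1≤o⇒1≤n (m p) (m*r≡n p 1≤p p≤k) (≤-trans 1≤n₁ n₁≤n) ,
    ≤-trans n₁≤n (≤-reflexive (sym (m*r≡n p 1≤p p≤k)))
    where
    n₁≤n : n 1 ≤ n p
    n₁≤n = mono 1 p ≤-refl 1≤p p≤k
  N/d≡Q : prodFromTo n 2 k /′ d ≡ prodFromTo (radix n m) 2 k
  N/d≡Q = prodFromTo-/′ n m 2 k d 1≤d (λ p 2≤p p≤k → sym (m*r≡n p (≤-trans (s≤s z≤n) 2≤p) p≤k)) ∏m≡d
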